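{- Let $\mathcal{L}$ be a family of balanced oriented algebraic laws. Assume that for all $f,g$ in the positive geometry monoid $G^+_{\mathcal{L}}$ there exist $f',g'\in G^+_{\mathcal{L}}$ with $f\bullet g'=g\bullet f'$ and such that the domain of $f\bullet g'$ is the intersection of the domains of $f$ and $g$. Then the rewrite system $R^+_{\mathcal{L}}$ is confluent.
   Context: Terms are built over a signature and an infinite set of variables. For a law $L=(l,r)$ (balanced: same variables on both sides) and address $\alpha$, $O^{L,+}_\alpha$ is the partial operator replacing the subterm $t/\alpha=l\sigma$ ($\sigma$ a substitution) by $r\sigma$. $G^+_{\mathcal{L}}$ is the monoid of partial operators generated by all $O^{L,+}_\alpha$, $L\in\mathcal{L}$, under the composition $f\bullet g$ = "first $f$, then $g$" (it contains the identity). $R^+_{\mathcal{L}}$ is the rewrite system with rules $l\to r$ for $(l,r)\in\mathcal{L}$, applied to substitution instances at any position. Confluence: whenever $t$ rewrites (in zero or more steps) to $t'$ and to $t''$, there is $t'''$ to which both $t'$ and $t''$ rewrite. -}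

module Defs where

open import Data.Nat using (ℕ; zero; suc)
open import Data.Vec using (Vec; []; _∷_)
open import Data.List using (List; []; _∷_)
open import Data.Maybe using (Maybe; just; nothing)
import Data.Maybe as Maybe
open import Data.Product using (Σ; ∃; _×_; _,_)
open import Relation.Binary.PropositionalEquality using (_≡_)
open import Relation.Binary.Construct.Closure.ReflexiveTransitive using (Star)

record Signature : Set₁ where
  field
    Sym   : Set
    arity : Sym → ℕ

open Signature

Var : Set
Var = ℕ

-- Addresses: finite sequences of argument indices (0-based).
Address : Set
Address = List ℕ

module _ (𝔖 : Signature) where

  data Term : Set where
    var : Var → Term
    app : (f : Sym 𝔖) → Vec Term (arity 𝔖 f) → Term

Law : Signature → Set
Law 𝔖 = Term 𝔖 × Term 𝔖

Subst : Signature → Set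
Subst 𝔖 = Var → Term 𝔖

-- Relations on terms are used as partial operators (they are functional
-- for the operators considered here).
PartialOp : Signature → Set₁
PartialOp 𝔖 = Term 𝔖 → Term 𝔖 → Set

module _ {𝔖 : Signature} where

  mutual
    _⟨_⟩ : Term 𝔖 → Subst 𝔖 → Term 𝔖
    var x ⟨ σ ⟩ = σ x
    app f ts ⟨ σ ⟩ = app f (substV ts σ)

    substV : ∀ {n} → Vec (Term 𝔖) n → Subst 𝔖 → Vec (Term 𝔖) n
    substV [] σ = []
    substV (t ∷ ts) σ = (t ⟨ σ ⟩) ∷ substV ts σ

  mutual
    _/_ : Term 𝔖 → Address → Maybe (Term 𝔖)
    t / [] = just t
    var x / (i ∷ α) = nothing
    app f ts / (i ∷ α) = subV ts i α

    subV : ∀ {n} → Vec (Term 𝔖) n → ℕ → Address → Maybe (Term 𝔖)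
    subV [] i α = nothing
    subV (t ∷ ts) zero α = t / α
    subV (t ∷ ts) (suc i) α = subV ts i α

  mutual
    replace : Term 𝔖 → Address → Term 𝔖 → Maybe (Term 𝔖)
    replace t [] u = just u
    replace (var x) (i ∷ α) u = nothing
    replace (app f ts) (i ∷ α) u = Maybe.map (app f) (replaceV ts i α u)

    replaceV : ∀ {n} → Vec (Term 𝔖) n → ℕ → Address → Term 𝔖 → Maybe (Vec (Term 𝔖) n)
    replaceV [] i α u = nothing
    replaceV (t ∷ ts) zero α u = Maybe.map (_∷ ts) (replace t α u)
    replaceV (t ∷ ts) (suc i) α u = Maybe.map (t ∷_) (replaceV ts i α u)

  mutual
    data _occursIn_ (x : Var) : Term 𝔖 → Set where
      here  : x occursIn var x
      there : ∀ {f ts} → x occursInV ts → x occursIn app f ts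

    data _occursInV_ (x : Var) : ∀ {n} → Vec (Term 𝔖) n → Set where
      hd : ∀ {n t} {ts : Vec (Term 𝔖) n} → x occursIn t → x occursInV (t ∷ ts)
      tl : ∀ {n t} {ts : Vec (Term 𝔖) n} → x occursInV ts → x occursInV (t ∷ ts)

  Balanced : Law 𝔖 → Set
  Balanced (l , r) = ∀ x → (x occursIn l → x occursIn r) × (x occursIn r → x occursIn l)

  O⁺ : Law 𝔖 → Address → PartialOp 𝔖
  O⁺ (l , r) α t t' =
    Σ (Subst 𝔖) λ σ → (t / α ≡ just (l ⟨ σ ⟩)) × (replace t α (r ⟨ σ ⟩) ≡ just t')

  _•_ : PartialOp 𝔖 → PartialOp 𝔖 → PartialOp 𝔖
  (f • g) t t'' = ∃ λ t' → f t t' × g t' t''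

  idOp : PartialOp 𝔖
  idOp t t' = t ≡ t'

  Dom : PartialOp 𝔖 → Term 𝔖 → Set
  Dom f t = ∃ λ t' → f t t'

  _≐_ : PartialOp 𝔖 → PartialOp 𝔖 → Set
  f ≐ g = ∀ t t' → (f t t' → g t t') × (g t t' → f t t')

  module _ (𝓛 : Law 𝔖 → Set) where

    Gen : Set
    Gen = Σ (Law 𝔖) (λ L → 𝓛 L) × Address

    ⟦_⟧ : List Gen → PartialOp 𝔖
    ⟦ [] ⟧ = idOp
    ⟦ ((L , _) , α) ∷ w ⟧ = O⁺ L α • ⟦ w ⟧

    InG⁺ : PartialOp 𝔖 → Set
    InG⁺ f = Σ (List Gen) λ w → ⟦ w ⟧ ≐ f

    Step : Term 𝔖 → Term 𝔖 → Set
    Step t t' = Σ (Term 𝔖) λ l → Σ (Term 𝔖) λ r → 𝓛 (l , r) ×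
      Σ Address λ α → Σ (Subst 𝔖) λ σ →
      (t / α ≡ just (l ⟨ σ ⟩)) × (replace t α (r ⟨ σ ⟩) ≡ just t')

  Confluent : (Term 𝔖 → Term 𝔖 → Set) → Set
  Confluent R = ∀ t t' t'' → Star R t t' → Star R t t'' →
    ∃ λ t''' → Star R t' t''' × Star R t'' t'''

{-# OPTIONS --safe #-}
module Submission where

-- A rewrite sequence t →* t' is a word of generators of G⁺ whose operator sends t to t'.
-- Every operator of G⁺ is a partial function: matching l against t/α fixes σ on the variables
-- of l, which for a balanced law include those of r. Given sequences t →* t' and t →* t'',
-- read as operators f and g, the hypothesis provides f', g' with f • g' = g • f' defined at t,
-- since t lies in Dom f ∩ Dom g. The common value t''' is reached through f and through g;
-- determinism forces the intermediate terms to be t' and t'', so t' →* t''' via g' and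
-- t'' →* t''' via f'.

open import Defs
open import Data.List using ([]; _∷_)
open import Data.Maybe.Properties using (just-injective)
open import Data.Product using (Σ; ∃; _×_; _,_; proj₁; proj₂)
open import Data.Vec using (Vec; []; _∷_)
open import Data.Vec.Properties using (∷-injectiveˡ; ∷-injectiveʳ)
open import Function.Base using (id)
open import Function.Bundles using (_⇔_; Equivalence)
open import Relation.Binary.Construct.Closure.ReflexiveTransitive using (Star; ε; _◅_)
open import Relation.Binary.PropositionalEquality using (_≡_; refl; sym; trans; cong; cong₂)
open import Relation.Binary.Rewriting using (Deterministic)

module _ {𝔖 : Signature} where

  _⊆ᵛ_ : Term 𝔖 → Term 𝔖 → Set
  r ⊆ᵛ l = ∀ x → x occursIn r → x occursIn l

  Balanced⇒⊆ᵛ : ∀ {l r} → Balanced (l , r) → r ⊆ᵛ l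
  Balanced⇒⊆ᵛ bal x = proj₂ (bal x)

  app-injective : ∀ {f} {ts us : Vec (Term 𝔖) (Signature.arity 𝔖 f)} →
    app f ts ≡ app f us → ts ≡ us
  app-injective refl = refl

  mutual
    ⟨⟩-cong-on-vars : ∀ r {σ σ' : Subst 𝔖} →
      (∀ {x} → x occursIn r → σ x ≡ σ' x) → r ⟨ σ ⟩ ≡ r ⟨ σ' ⟩
    ⟨⟩-cong-on-vars (var x)    agree = agree here
    ⟨⟩-cong-on-vars (app f ts) agree = cong (app f) (substV-cong-on-vars ts (λ o → agree (there o)))

    substV-cong-on-vars : ∀ {n} (ts : Vec (Term 𝔖) n) {σ σ' : Subst 𝔖} →
      (∀ {x} → x occursInV ts → σ x ≡ σ' x) → substV ts σ ≡ substV ts σ'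
    substV-cong-on-vars []       agree = refl
    substV-cong-on-vars (t ∷ ts) agree =
      cong₂ _∷_ (⟨⟩-cong-on-vars t (λ o → agree (hd o))) (substV-cong-on-vars ts (λ o → agree (tl o)))

  mutual
    ⟨⟩-injective-on-vars : ∀ l {σ σ' : Subst 𝔖} →
      l ⟨ σ ⟩ ≡ l ⟨ σ' ⟩ → ∀ {x} → x occursIn l → σ x ≡ σ' x
    ⟨⟩-injective-on-vars (var x)    eq here      = eq
    ⟨⟩-injective-on-vars (app f ts) eq (there o) = substV-injective-on-vars ts (app-injective eq) o

    substV-injective-on-vars : ∀ {n} (ts : Vec (Term 𝔖) n) {σ σ' : Subst 𝔖} →
      substV ts σ ≡ substV ts σ' → ∀ {x} → x occursInV ts → σ x ≡ σ' x
    substV-injective-on-vars (t ∷ ts) eq (hd o) = ⟨⟩-injective-on-vars t (∷-injectiveˡ eq) o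
    substV-injective-on-vars (t ∷ ts) eq (tl o) = substV-injective-on-vars ts (∷-injectiveʳ eq) o

  O⁺-deterministic : ∀ {l r} α → r ⊆ᵛ l → Deterministic _≡_ (O⁺ (l , r) α)
  O⁺-deterministic {l} {r} α r⊆l {t} (σ , matchσ , replσ) (σ' , matchσ' , replσ') =
    just-injective (trans (sym replσ) (trans (cong (replace t α) rσ≡rσ') replσ'))
    where
      lσ≡lσ' : l ⟨ σ ⟩ ≡ l ⟨ σ' ⟩
      lσ≡lσ' = just-injective (trans (sym matchσ) matchσ')

      rσ≡rσ' : r ⟨ σ ⟩ ≡ r ⟨ σ' ⟩
      rσ≡rσ' = ⟨⟩-cong-on-vars r (λ o → ⟨⟩-injective-on-vars l lσ≡lσ' (r⊆l _ o))

  idOp-deterministic : Deterministic _≡_ (idOp {𝔖})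
  idOp-deterministic p q = trans (sym p) q

  •-deterministic : ∀ {f g : PartialOp 𝔖} →
    Deterministic _≡_ f → Deterministic _≡_ g → Deterministic _≡_ (f • g)
  •-deterministic f-det g-det (m , fm , gm) (m' , fm' , gm') with f-det fm fm'
  ... | refl = g-det gm gm'

  square-joins : ∀ {f g f' g' : PartialOp 𝔖} →
    Deterministic _≡_ f → Deterministic _≡_ g → (f • g') ≐ (g • f') →
    (∀ {t} → Dom f t × Dom g t → Dom (f • g') t) →
    ∀ {t t₁ t₂} → f t t₁ → g t t₂ → ∃ λ t₃ → g' t₁ t₃ × f' t₂ t₃
  square-joins f-det g-det square dom {t} ft gt
    with dom ((_ , ft) , (_ , gt))
  ... | t₃ , m , fm , g'm
    with proj₁ (square t t₃) (m , fm , g'm)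
  ... | m' , gm' , f'm' with f-det ft fm | g-det gt gm'
  ... | refl | refl = t₃ , g'm , f'm'

module _ {𝔖 : Signature} (𝓛 : Law 𝔖 → Set) where

  ⟦⟧-deterministic : (∀ {l r} → 𝓛 (l , r) → r ⊆ᵛ l) → ∀ w → Deterministic _≡_ (⟦ 𝓛 ⟧ w)
  ⟦⟧-deterministic r⊆l []                          = idOp-deterministic
  ⟦⟧-deterministic r⊆l ((((l , r) , L∈𝓛) , α) ∷ w) =
    •-deterministic {f = O⁺ (l , r) α} {g = ⟦ 𝓛 ⟧ w}
      (O⁺-deterministic α (r⊆l L∈𝓛)) (⟦⟧-deterministic r⊆l w)

  ⟦⟧-InG⁺ : ∀ w → InG⁺ 𝓛 (⟦ 𝓛 ⟧ w)
  ⟦⟧-InG⁺ w = w , λ _ _ → id , id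

  Star⇒⟦⟧ : ∀ {t t'} → Star (Step 𝓛) t t' → ∃ λ w → ⟦ 𝓛 ⟧ w t t'
  Star⇒⟦⟧ ε = [] , refl
  Star⇒⟦⟧ ((l , r , L∈𝓛 , α , σ , match , repl) ◅ steps) with Star⇒⟦⟧ steps
  ... | w , ⟦w⟧ = (((l , r) , L∈𝓛) , α) ∷ w , _ , (σ , match , repl) , ⟦w⟧

  ⟦⟧⇒Star : ∀ w {t t'} → ⟦ 𝓛 ⟧ w t t' → Star (Step 𝓛) t t'
  ⟦⟧⇒Star [] refl = ε
  ⟦⟧⇒Star ((((l , r) , L∈𝓛) , α) ∷ w) (_ , (σ , match , repl) , ⟦w⟧) =
    (l , r , L∈𝓛 , α , σ , match , repl) ◅ ⟦⟧⇒Star w ⟦w⟧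

  InG⁺⇒Star : ∀ {f} → InG⁺ 𝓛 f → ∀ {t t'} → f t t' → Star (Step 𝓛) t t'
  InG⁺⇒Star (w , ⟦w⟧≐f) {t} {t'} ft' = ⟦⟧⇒Star w (proj₂ (⟦w⟧≐f t t') ft')

proposition5p2 : (𝔖 : Signature) (𝓛 : Law 𝔖 → Set) →
    (∀ L → 𝓛 L → Balanced L) →
    (∀ (f g : PartialOp 𝔖) → InG⁺ 𝓛 f → InG⁺ 𝓛 g →
      Σ (PartialOp 𝔖) λ f' → Σ (PartialOp 𝔖) λ g' →
        InG⁺ 𝓛 f' × InG⁺ 𝓛 g' × ((f • g') ≐ (g • f')) ×
        (∀ t → Dom (f • g') t ⇔ (Dom f t × Dom g t))) →
    Confluent (Step 𝓛)
proposition5p2 𝔖 𝓛 balanced complement t t' t'' t→t' t→t'' =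
  let w₁ , ⟦w₁⟧ = Star⇒⟦⟧ 𝓛 t→t'
      w₂ , ⟦w₂⟧ = Star⇒⟦⟧ 𝓛 t→t''
      f' , g' , f'∈G⁺ , g'∈G⁺ , square , dom =
        complement (⟦ 𝓛 ⟧ w₁) (⟦ 𝓛 ⟧ w₂) (⟦⟧-InG⁺ 𝓛 w₁) (⟦⟧-InG⁺ 𝓛 w₂)
      t''' , g't' , f't'' =
        square-joins (deterministic w₁) (deterministic w₂) square
          (λ {s} → Equivalence.from (dom s)) ⟦w₁⟧ ⟦w₂⟧
  in t''' , InG⁺⇒Star 𝓛 g'∈G⁺ g't' , InG⁺⇒Star 𝓛 f'∈G⁺ f't''
  where
    deterministic : ∀ w → Deterministic _≡_ (⟦ 𝓛 ⟧ w)
    deterministic = ⟦⟧-deterministic 𝓛 (λ L∈𝓛 → Balanced⇒⊆ᵛ (balanced _ L∈𝓛))
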